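{- Let $A' \in \mathrm{ASM}(n-k)$ and $A\in\mathrm{ASM}(n)$, and suppose the upper-left $(n-k)\times(n-k)$ block of $A$ equals $A'$, i.e. $A = \begin{pmatrix} A' & *\\ * & *\end{pmatrix}$. Then $A = A' \oplus B$ (block diagonal sum) for some $B \in \mathrm{ASM}(k)$.
   Context: An alternating sign matrix (ASM) of size $n$ is an $n\times n$ matrix with entries in $\{ -1,0,1\}$ such that each row and each column sums to $1$ and the nonzero entries in each row and each column alternate in sign; $\mathrm{ASM}(n)$ is the set of these. -}

module Defs where

open import Data.Nat using (ℕ; _+_)
open import Data.Integer as ℤ using (ℤ; 0ℤ; 1ℤ; -1ℤ)
open import Data.Fin using (Fin; splitAt)
open import Data.Sum using (_⊎_; inj₁; inj₂)
open import Data.List using (List; []; _∷_; map; filter; foldr)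
open import Data.List.Relation.Unary.All using (All)
open import Data.Vec.Functional using () renaming (toList to vtoList)
open import Data.Product using (_×_)
open import Relation.Binary.PropositionalEquality using (_≡_; _≢_)
open import Relation.Nullary using (¬_)
open import Relation.Nullary.Decidable using (¬?)
open import Data.Fin using () renaming (Fin to F)
import Data.Integer.Properties as ℤP

Matrix : ℕ → Set
Matrix n = Fin n → Fin n → ℤ

data IsSignEntry : ℤ → Set where
  is-1 : IsSignEntry -1ℤ
  is0  : IsSignEntry 0ℤ
  is1  : IsSignEntry 1ℤ

sumℤ : List ℤ → ℤ
sumℤ = foldr ℤ._+_ 0ℤ

nonzeros : List ℤ → List ℤ
nonzeros = filter (λ x → ¬? (x ℤP.≟ 0ℤ))

data Alternating : List ℤ → Set where
  alt-[]  : Alternating []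
  alt-[x] : ∀ {x} → Alternating (x ∷ [])
  alt-∷   : ∀ {x y xs} → ℤ._*_ x y ℤ.< 0ℤ → Alternating (y ∷ xs) → Alternating (x ∷ y ∷ xs)

row : ∀ {n} → Matrix n → Fin n → List ℤ
row A i = vtoList (λ j → A i j)

col : ∀ {n} → Matrix n → Fin n → List ℤ
col A j = vtoList (λ i → A i j)

record IsASM {n : ℕ} (A : Matrix n) : Set where
  field
    entries  : ∀ i j → IsSignEntry (A i j)
    rowSum   : ∀ i → sumℤ (row A i) ≡ 1ℤ
    colSum   : ∀ j → sumℤ (col A j) ≡ 1ℤ
    rowAlt   : ∀ i → Alternating (nonzeros (row A i))
    colAlt   : ∀ j → Alternating (nonzeros (col A j))

_⊕_ : ∀ {m k} → Matrix m → Matrix k → Matrix (m + k)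
_⊕_ {m} A' B i j with splitAt m i | splitAt m j
... | inj₁ i' | inj₁ j' = A' i' j'
... | inj₂ i' | inj₂ j' = B i' j'
... | inj₁ _  | inj₂ _  = 0ℤ
... | inj₂ _  | inj₁ _  = 0ℤ

{-# OPTIONS --safe #-}
module Submission where

-- In an alternating sign row with sum 1 the nonzero entries read 1, -1, 1, ..., -1, 1: the
-- first of them is 1, and a nonzero entry following a prefix of sum 1 is -1. Were the
-- upper-right block of A nonzero, its first nonzero entry in row-major order would follow the
-- corresponding row of A' (sum 1) in its row of A, and only zeros in its column of A, so it
-- would be both -1 and 1. Transposing, the lower-left block vanishes as well, and the
-- lower-right block B is an ASM because dropping zeros changes neither sums nor alternation.

open import Defs
open import Data.Nat using (ℕ; _+_; zero; suc)
open import Data.Fin using (Fin; _↑ˡ_; _↑ʳ_; splitAt; zero; suc)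
open import Data.Fin.Properties using (splitAt⁻¹-↑ˡ; splitAt⁻¹-↑ʳ)
open import Data.Integer as ℤ using (ℤ; 0ℤ; 1ℤ; -1ℤ)
import Data.Integer.Properties as ℤP
open import Data.List using (List; []; _∷_; _++_; tabulate; head)
open import Data.List.Properties using (filter-++; filter-accept; filter-none; tabulate-cong)
open import Data.List.Relation.Unary.All using (All; []; _∷_)
open import Data.List.Relation.Unary.All.Properties using (tabulate⁺)
open import Data.Maybe using (Maybe; just)
open import Data.Product using (Σ; ∃; ∃₂; _×_; _,_)
open import Data.Sum using (_⊎_; inj₁; inj₂)
open import Function using (_∘_; flip)
open import Relation.Binary.PropositionalEquality
open import Relation.Nullary using (yes; no)
open import Relation.Nullary.Decidable using (¬?)
open import Relation.Unary using (Decidable)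

open ≡-Reasoning

data IsUnit : ℤ → Set where
  plus  : IsUnit 1ℤ
  minus : IsUnit -1ℤ

AlternatingUnits : List ℤ → Set
AlternatingUnits xs = All IsUnit xs × Alternating xs

alternating-tail : ∀ {x xs} → Alternating (x ∷ xs) → Alternating xs
alternating-tail {xs = []}    _           = alt-[]
alternating-tail {xs = _ ∷ _} (alt-∷ _ a) = a

units-of-opposite-sign-cancel : ∀ {x y} → IsUnit x → IsUnit y → x ℤ.* y ℤ.< 0ℤ → x ℤ.+ y ≡ 0ℤ
units-of-opposite-sign-cancel plus  plus  (ℤ.+<+ ())
units-of-opposite-sign-cancel plus  minus _ = refl
units-of-opposite-sign-cancel minus plus  _ = refl
units-of-opposite-sign-cancel minus minus (ℤ.+<+ ())

sumℤ-cancel : ∀ {x y} zs → x ℤ.+ y ≡ 0ℤ → sumℤ (x ∷ y ∷ zs) ≡ sumℤ zs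
sumℤ-cancel {x} {y} zs x+y≡0 = begin
  x ℤ.+ (y ℤ.+ sumℤ zs)  ≡⟨ ℤP.+-assoc x y (sumℤ zs) ⟨
  (x ℤ.+ y) ℤ.+ sumℤ zs  ≡⟨ cong (ℤ._+ sumℤ zs) x+y≡0 ⟩
  0ℤ ℤ.+ sumℤ zs         ≡⟨ ℤP.+-identityˡ (sumℤ zs) ⟩
  sumℤ zs                ∎

head-of-sum-one : ∀ {x xs} → AlternatingUnits (x ∷ xs) → sumℤ (x ∷ xs) ≡ 1ℤ → x ≡ 1ℤ
head-of-sum-one (plus ∷ _ , _) _ = refl
head-of-sum-one (minus ∷ [] , _) ()
head-of-sum-one (minus ∷ minus ∷ _ , alt-∷ (ℤ.+<+ ()) _) _
head-of-sum-one (minus ∷ plus ∷ [] , _) ()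
head-of-sum-one (minus ∷ plus ∷ plus ∷ _ , alt-∷ _ (alt-∷ (ℤ.+<+ ()) _)) _
head-of-sum-one {xs = _ ∷ xs} (minus ∷ plus ∷ us@(minus ∷ _) , alt-∷ _ (alt-∷ _ alt)) sum≡1 =
  head-of-sum-one (us , alt) (trans (sym (sumℤ-cancel {x = -1ℤ} {y = 1ℤ} xs refl)) sum≡1)

next-after-sum-one : ∀ xs {y ys} → AlternatingUnits (xs ++ y ∷ ys) → sumℤ xs ≡ 1ℤ → y ≡ -1ℤ
next-after-sum-one []           _ ()
next-after-sum-one (_ ∷ [])     (plus ∷ minus ∷ _ , _) _ = refl
next-after-sum-one (_ ∷ [])     (plus ∷ plus ∷ _ , alt-∷ (ℤ.+<+ ()) _) _
next-after-sum-one (_ ∷ [])     (minus ∷ _ , _) ()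
next-after-sum-one (x ∷ x′ ∷ xs) (u ∷ u′ ∷ us , alt-∷ u*u′<0 alt) sum≡1 =
  next-after-sum-one xs (us , alternating-tail alt)
    (trans (sym (sumℤ-cancel {x} {x′} xs (units-of-opposite-sign-cancel u u′ u*u′<0))) sum≡1)

nonzero? : Decidable (_≢ 0ℤ)
nonzero? x = ¬? (x ℤP.≟ 0ℤ)

nonzeros-++ : ∀ xs ys → nonzeros (xs ++ ys) ≡ nonzeros xs ++ nonzeros ys
nonzeros-++ = filter-++ nonzero?

sumℤ-nonzeros : ∀ xs → sumℤ (nonzeros xs) ≡ sumℤ xs
sumℤ-nonzeros [] = refl
sumℤ-nonzeros (x ∷ xs) with x ℤP.≟ 0ℤ
... | yes refl = trans (sumℤ-nonzeros xs) (sym (ℤP.+-identityˡ (sumℤ xs)))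
... | no _     = cong (ℤ._+_ x) (sumℤ-nonzeros xs)

nonzeros-units : ∀ {xs} → All IsSignEntry xs → All IsUnit (nonzeros xs)
nonzeros-units []          = []
nonzeros-units (is-1 ∷ ps) = minus ∷ nonzeros-units ps
nonzeros-units (is0 ∷ ps)  = nonzeros-units ps
nonzeros-units (is1 ∷ ps)  = plus ∷ nonzeros-units ps

leading : List ℤ → Maybe ℤ
leading xs = head (nonzeros xs)

leading-∷-zero : ∀ {x} xs → x ≡ 0ℤ → leading (x ∷ xs) ≡ leading xs
leading-∷-zero xs refl = refl

leading-∷-nonzero : ∀ {x} xs → x ≢ 0ℤ → leading (x ∷ xs) ≡ just x
leading-∷-nonzero xs x≢0 = cong head (filter-accept nonzero? {xs = xs} x≢0)

nonzeros-leading : ∀ xs {x} → leading xs ≡ just x → ∃ λ rest → nonzeros xs ≡ x ∷ rest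
nonzeros-leading xs lead with nonzeros xs
... | y ∷ rest with refl ← lead = rest , refl

leading-++ : ∀ xs ys {x} → leading xs ≡ just x → leading (xs ++ ys) ≡ just x
leading-++ xs ys {x} lead with nonzeros-leading xs lead
... | rest , nz-xs = begin
  head (nonzeros (xs ++ ys))         ≡⟨ cong head (nonzeros-++ xs ys) ⟩
  head (nonzeros xs ++ nonzeros ys)  ≡⟨ cong (λ zs → head (zs ++ nonzeros ys)) nz-xs ⟩
  just x                             ∎

leading-of-sum-one : ∀ xs {x} → AlternatingUnits (nonzeros xs) → sumℤ xs ≡ 1ℤ →
                     leading xs ≡ just x → x ≡ 1ℤ
leading-of-sum-one xs {x} alt sum≡1 lead with nonzeros-leading xs lead
... | rest , nz-xs = head-of-sum-one (subst AlternatingUnits nz-xs alt)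
  (begin
    sumℤ (x ∷ rest)     ≡⟨ cong sumℤ nz-xs ⟨
    sumℤ (nonzeros xs)  ≡⟨ sumℤ-nonzeros xs ⟩
    sumℤ xs             ≡⟨ sum≡1 ⟩
    1ℤ                  ∎)

leading-after-sum-one : ∀ xs ys {y} → AlternatingUnits (nonzeros (xs ++ ys)) → sumℤ xs ≡ 1ℤ →
                        leading ys ≡ just y → y ≡ -1ℤ
leading-after-sum-one xs ys alt sum≡1 lead with nonzeros-leading ys lead
... | rest , nz-ys = next-after-sum-one (nonzeros xs)
  (subst AlternatingUnits (trans (nonzeros-++ xs ys) (cong (nonzeros xs ++_) nz-ys)) alt)
  (trans (sumℤ-nonzeros xs) sum≡1)

leading-tabulate : ∀ {n} (f : Fin n → ℤ) →
                   (∀ j → f j ≡ 0ℤ) ⊎ ∃ λ j → f j ≢ 0ℤ × leading (tabulate f) ≡ just (f j)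
leading-tabulate {zero}  f = inj₁ λ ()
leading-tabulate {suc n} f with f zero ℤP.≟ 0ℤ
... | no f₀≢0  = inj₂ (zero , f₀≢0 , refl)
... | yes f₀≡0 with leading-tabulate (f ∘ suc)
...   | inj₁ f∘suc≡0 = inj₁ λ { zero → f₀≡0 ; (suc j) → f∘suc≡0 j }
...   | inj₂ (j , fj≢0 , lead) = inj₂ (suc j , fj≢0 , lead)

zero⊎leading-in-row-and-column : ∀ {m k} (C : Fin m → Fin k → ℤ) →
  (∀ i j → C i j ≡ 0ℤ) ⊎
  ∃₂ λ i j → leading (tabulate (C i)) ≡ just (C i j) × leading (tabulate (λ r → C r j)) ≡ just (C i j)
zero⊎leading-in-row-and-column {zero}  C = inj₁ λ ()
zero⊎leading-in-row-and-column {suc m} C with leading-tabulate (C zero)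
... | inj₂ (j , C₀j≢0 , lead) = inj₂ (zero , j , lead , leading-∷-nonzero _ C₀j≢0)
... | inj₁ C₀≡0 with zero⊎leading-in-row-and-column (C ∘ suc)
...   | inj₁ C∘suc≡0 = inj₁ λ { zero → C₀≡0 ; (suc i) → C∘suc≡0 i }
...   | inj₂ (i , j , row-lead , col-lead) =
        inj₂ (suc i , j , row-lead , trans (leading-∷-zero _ (C₀≡0 j)) col-lead)

tabulate-↑ : ∀ m {k} (f : Fin (m + k) → ℤ) →
             tabulate f ≡ tabulate (f ∘ (_↑ˡ k)) ++ tabulate (f ∘ (m ↑ʳ_))
tabulate-↑ zero    f = refl
tabulate-↑ (suc m) f = cong (f zero ∷_) (tabulate-↑ m (f ∘ suc))

nonzeros-tabulate-↑ʳ : ∀ m {k} (f : Fin (m + k) → ℤ) → (∀ i → f (i ↑ˡ k) ≡ 0ℤ) →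
                       nonzeros (tabulate f) ≡ nonzeros (tabulate (f ∘ (m ↑ʳ_)))
nonzeros-tabulate-↑ʳ m {k} f f↑ˡ≡0 = begin
  nonzeros (tabulate f)                ≡⟨ cong nonzeros (tabulate-↑ m f) ⟩
  nonzeros (left ++ right)             ≡⟨ nonzeros-++ left right ⟩
  nonzeros left ++ nonzeros right      ≡⟨ cong (_++ nonzeros right) nonzeros-left ⟩
  nonzeros right                       ∎
  where
    left  = tabulate (f ∘ (_↑ˡ k))
    right = tabulate (f ∘ (m ↑ʳ_))

    nonzeros-left : nonzeros left ≡ []
    nonzeros-left = filter-none nonzero? (tabulate⁺ λ i fi≢0 → fi≢0 (f↑ˡ≡0 i))

sumℤ-cong-nonzeros : ∀ xs ys → nonzeros xs ≡ nonzeros ys → sumℤ xs ≡ sumℤ ys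
sumℤ-cong-nonzeros xs ys eq = begin
  sumℤ xs             ≡⟨ sumℤ-nonzeros xs ⟨
  sumℤ (nonzeros xs)  ≡⟨ cong sumℤ eq ⟩
  sumℤ (nonzeros ys)  ≡⟨ sumℤ-nonzeros ys ⟩
  sumℤ ys             ∎

module _ {n : ℕ} {A : Matrix n} (asm : IsASM A) where
  open IsASM asm

  IsASM-flip : IsASM (flip A)
  IsASM-flip = record
    { entries = flip entries
    ; rowSum  = colSum
    ; colSum  = rowSum
    ; rowAlt  = colAlt
    ; colAlt  = rowAlt
    }

  row-alternating-units : ∀ i → AlternatingUnits (nonzeros (row A i))
  row-alternating-units i = nonzeros-units (tabulate⁺ (entries i)) , rowAlt i

module _ {m k : ℕ} {A : Matrix (m + k)} (asm : IsASM A)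
         (upper-left-rowSum : ∀ i → sumℤ (tabulate λ j → A (i ↑ˡ k) (j ↑ˡ k)) ≡ 1ℤ) where

  private
    C : Fin m → Fin k → ℤ
    C i j = A (i ↑ˡ k) (m ↑ʳ j)

    row-leading : ∀ i {x} → leading (tabulate (C i)) ≡ just x → x ≡ -1ℤ
    row-leading i = leading-after-sum-one (tabulate λ j → A (i ↑ˡ k) (j ↑ˡ k)) (tabulate (C i))
      (subst (AlternatingUnits ∘ nonzeros) (tabulate-↑ m (A (i ↑ˡ k))) (row-alternating-units asm (i ↑ˡ k)))
      (upper-left-rowSum i)

    column-leading : ∀ j {x} → leading (tabulate (λ i → C i j)) ≡ just x → x ≡ 1ℤ
    column-leading j {x} lead = leading-of-sum-one (col A (m ↑ʳ j))
      (row-alternating-units (IsASM-flip asm) (m ↑ʳ j))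
      (IsASM.colSum asm (m ↑ʳ j))
      (begin
        leading (col A (m ↑ʳ j))                   ≡⟨ cong leading (tabulate-↑ m (λ r → A r (m ↑ʳ j))) ⟩
        leading (tabulate (λ i → C i j) ++ lower)  ≡⟨ leading-++ (tabulate (λ i → C i j)) lower lead ⟩
        just x                                     ∎)
      where lower = tabulate (λ i → A (m ↑ʳ i) (m ↑ʳ j))

  upper-right-zero : ∀ i j → A (i ↑ˡ k) (m ↑ʳ j) ≡ 0ℤ
  upper-right-zero with zero⊎leading-in-row-and-column C
  ... | inj₁ C≡0 = C≡0
  ... | inj₂ (i , j , row-lead , col-lead)
    with () ← trans (sym (row-leading i row-lead)) (column-leading j col-lead)

lower-right : ∀ {m k} → Matrix (m + k) → Matrix k
lower-right {m} A i j = A (m ↑ʳ i) (m ↑ʳ j)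

lower-right-isASM : ∀ {m k} {A : Matrix (m + k)} → IsASM A →
                    (∀ i j → A (i ↑ˡ k) (m ↑ʳ j) ≡ 0ℤ) → (∀ i j → A (m ↑ʳ i) (j ↑ˡ k) ≡ 0ℤ) →
                    IsASM (lower-right A)
lower-right-isASM {m} {k} {A} asm upper-right≡0 lower-left≡0 = record
  { entries = λ i j → entries (m ↑ʳ i) (m ↑ʳ j)
  ; rowSum  = λ i → trans (sym (sumℤ-cong-nonzeros (row A (m ↑ʳ i)) (row (lower-right A) i) (row-nonzeros i)))
                          (rowSum (m ↑ʳ i))
  ; colSum  = λ j → trans (sym (sumℤ-cong-nonzeros (col A (m ↑ʳ j)) (col (lower-right A) j) (col-nonzeros j)))
                          (colSum (m ↑ʳ j))
  ; rowAlt  = λ i → subst Alternating (row-nonzeros i) (rowAlt (m ↑ʳ i))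
  ; colAlt  = λ j → subst Alternating (col-nonzeros j) (colAlt (m ↑ʳ j))
  }
  where
    open IsASM asm

    row-nonzeros : ∀ i → nonzeros (row A (m ↑ʳ i)) ≡ nonzeros (row (lower-right A) i)
    row-nonzeros i = nonzeros-tabulate-↑ʳ m (A (m ↑ʳ i)) (lower-left≡0 i)

    col-nonzeros : ∀ j → nonzeros (col A (m ↑ʳ j)) ≡ nonzeros (col (lower-right A) j)
    col-nonzeros j = nonzeros-tabulate-↑ʳ m (λ r → A r (m ↑ʳ j)) (λ i → upper-right≡0 i j)

block-diagonal : ∀ {m k} {A' : Matrix m} (A : Matrix (m + k)) →
                 (∀ i j → A (i ↑ˡ k) (j ↑ˡ k) ≡ A' i j) →
                 (∀ i j → A (i ↑ˡ k) (m ↑ʳ j) ≡ 0ℤ) → (∀ i j → A (m ↑ʳ i) (j ↑ˡ k) ≡ 0ℤ) →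
                 ∀ i j → A i j ≡ (A' ⊕ lower-right A) i j
block-diagonal {m} A upper-left upper-right lower-left i j with splitAt m i in i≡ | splitAt m j in j≡
... | inj₁ i′ | inj₁ j′ =
  trans (cong₂ A (sym (splitAt⁻¹-↑ˡ i≡)) (sym (splitAt⁻¹-↑ˡ j≡))) (upper-left i′ j′)
... | inj₁ i′ | inj₂ j′ =
  trans (cong₂ A (sym (splitAt⁻¹-↑ˡ i≡)) (sym (splitAt⁻¹-↑ʳ j≡))) (upper-right i′ j′)
... | inj₂ i′ | inj₁ j′ =
  trans (cong₂ A (sym (splitAt⁻¹-↑ʳ i≡)) (sym (splitAt⁻¹-↑ˡ j≡))) (lower-left i′ j′)
... | inj₂ i′ | inj₂ j′ = cong₂ A (sym (splitAt⁻¹-↑ʳ i≡)) (sym (splitAt⁻¹-↑ʳ j≡))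

corollary4p4 : (m k : ℕ) (A' : Matrix m) (A : Matrix (m + k)) →
    IsASM A' → IsASM A →
    (∀ (i j : Fin m) → A (i ↑ˡ k) (j ↑ˡ k) ≡ A' i j) →
    Σ (Matrix k) (λ B → IsASM B × (∀ (i j : Fin (m + k)) → A i j ≡ (A' ⊕ B) i j))
corollary4p4 m k A' A asm' asm upper-left =
  lower-right A , lower-right-isASM asm upper-right≡0 lower-left≡0 ,
  block-diagonal A upper-left upper-right≡0 lower-left≡0
  where
    upper-right≡0 : ∀ i j → A (i ↑ˡ k) (m ↑ʳ j) ≡ 0ℤ
    upper-right≡0 = upper-right-zero asm λ i →
      trans (cong sumℤ (tabulate-cong (upper-left i))) (IsASM.rowSum asm' i)

    lower-left≡0 : ∀ i j → A (m ↑ʳ i) (j ↑ˡ k) ≡ 0ℤ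
    lower-left≡0 i j = upper-right-zero (IsASM-flip asm) (λ j →
      trans (cong sumℤ (tabulate-cong (λ i → upper-left i j))) (IsASM.colSum asm' j)) j i
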